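{- The theory \textsf{MLS} (Multi-Level Syllogistic) is convex: for every conjunction $\varphi$ of \textsf{MLS}-literals and every finite nonempty set $\{x_1 = y_1, \ldots, x_n = y_n\}$ of equalities between set variables, if $\models \varphi \rightarrow \bigvee_{i=1}^n x_i = y_i$, then $\models \varphi \rightarrow x_i = y_i$ for some $i \in \{1,\ldots,n\}$.
   Context: \textsf{MLS} is the quantifier-free propositional closure of atoms of the types $x = \varnothing$, $x = y$, $x \subseteq y$, $x \in y$, $x = y \setminus z$, $x = y \cup z$, $x = y \cap z$, where $x,y,z$ are set variables; an \textsf{MLS}-literal is such an atom or its negation. A set assignment $M$ is a map from a finite set of set variables into the von Neumann universe $\mathcal{V} = \bigcup_{\alpha \in \mathit{On}} \mathcal{V}_\alpha$ (with $\mathcal{V}_\alpha = \bigcup_{\beta<\alpha}\mathcal{P}(\mathcal{V}_\beta)$); the symbols $\varnothing, =, \subseteq, \in, \setminus, \cup, \cap$ and the propositional connectives are interpreted with their usual set-theoretic/Boolean meaning. A formula is true under $M$ (written $M \models \varphi$) according to this interpretation, and $\models \psi$ means that $\psi$ is true under every set assignment defined on the variables of $\psi$. -}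

module Defs where

open import Level using (0ℓ)
open import Data.Nat using (ℕ)
open import Data.Product using (Σ; ∃; _×_; _,_; proj₁)
open import Data.Sum using (_⊎_; inj₁; inj₂)
open import Data.Empty using (⊥)
open import Data.List using (List)
open import Data.List.NonEmpty using (List⁺; toList)
open import Data.List.Relation.Unary.All using (All)
open import Data.List.Relation.Unary.Any using (Any)
open import Relation.Nullary using (¬_)

-- The cumulative hierarchy of (well-founded) sets: Aczel's iterative
-- sets, with extensional equality _≐_ and membership _∈ᵥ_.

data V : Set₁ where
  sup : (A : Set) → (A → V) → V

_≐_ : V → V → Set
sup A f ≐ sup B g = ((a : A) → Σ B (λ b → f a ≐ g b))
                  × ((b : B) → Σ A (λ a → f a ≐ g b))

_∈ᵥ_ : V → V → Set
x ∈ᵥ sup B g = Σ B (λ b → x ≐ g b)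

_⊆ᵥ_ : V → V → Set
sup A f ⊆ᵥ y = (a : A) → f a ∈ᵥ y

∅ᵥ : V
∅ᵥ = sup ⊥ (λ ())

_∪ᵥ_ : V → V → V
sup A f ∪ᵥ sup B g = sup (A ⊎ B) h
  where
  h : A ⊎ B → V
  h (inj₁ a) = f a
  h (inj₂ b) = g b

_∩ᵥ_ : V → V → V
sup A f ∩ᵥ z = sup (Σ A (λ a → f a ∈ᵥ z)) (λ p → f (proj₁ p))

_∖ᵥ_ : V → V → V
sup A f ∖ᵥ z = sup (Σ A (λ a → ¬ (f a ∈ᵥ z))) (λ p → f (proj₁ p))

Var : Set
Var = ℕ

data Atom : Set where
  _=∅      : Var → Atom
  _≡ₐ_     : Var → Var → Atom
  _⊆ₐ_     : Var → Var → Atom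
  _∈ₐ_     : Var → Var → Atom
  _≔_∖ₐ_   : Var → Var → Var → Atom
  _≔_∪ₐ_   : Var → Var → Var → Atom
  _≔_∩ₐ_   : Var → Var → Var → Atom

data Literal : Set where
  pos : Atom → Literal
  neg : Atom → Literal

Conj : Set
Conj = List Literal

Assignment : Set₁
Assignment = Var → V

⟦_⟧ᵃ : Atom → Assignment → Set
⟦ x =∅ ⟧ᵃ M = M x ≐ ∅ᵥ
⟦ x ≡ₐ y ⟧ᵃ M = M x ≐ M y
⟦ x ⊆ₐ y ⟧ᵃ M = M x ⊆ᵥ M y
⟦ x ∈ₐ y ⟧ᵃ M = M x ∈ᵥ M y
⟦ x ≔ y ∖ₐ z ⟧ᵃ M = M x ≐ (M y ∖ᵥ M z)
⟦ x ≔ y ∪ₐ z ⟧ᵃ M = M x ≐ (M y ∪ᵥ M z)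
⟦ x ≔ y ∩ₐ z ⟧ᵃ M = M x ≐ (M y ∩ᵥ M z)

⟦_⟧ˡ : Literal → Assignment → Set
⟦ pos a ⟧ˡ M = ⟦ a ⟧ᵃ M
⟦ neg a ⟧ˡ M = ¬ ⟦ a ⟧ᵃ M

⟦_⟧ᶜ : Conj → Assignment → Set
⟦ φ ⟧ᶜ M = All (λ l → ⟦ l ⟧ˡ M) φ

Equality : Set
Equality = Var × Var

⟦_⟧ᵉ : Equality → Assignment → Set
⟦ (x , y) ⟧ᵉ M = M x ≐ M y

ValidImpDisj : Conj → List⁺ Equality → Set₁
ValidImpDisj φ eqs = (M : Assignment) → ⟦ φ ⟧ᶜ M → Any (λ e → ⟦ e ⟧ᵉ M) (toList eqs)

ValidImpEq : Conj → Equality → Set₁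
ValidImpEq φ e = (M : Assignment) → ⟦ φ ⟧ᶜ M → ⟦ e ⟧ᵉ M

module Submission where

-- Convexity follows from an amalgamation property of models. Given models M and N of a
-- conjunction φ of MLS-literals, let
--   C w = {C w' ∣ M w' ∈ M w} ∪ {⟨true , u⟩ ∣ u ∈ M w} ∪ {⟨false , u⟩ ∣ u ∈ N w},
-- where the tags ⟨k , u⟩ are chosen so that no value C w' is a tag. Every member of some C v
-- lies in exactly those C y for which a fixed element of M lies in M y, or one of N in N y, so
-- Boolean literals (x = ∅, =, ⊆, ∪, ∩, ∖) true in both M and N hold in C, and membership
-- between values follows M. The tagged copies recover M and N from C, which carries the negated
-- literals over and shows that C x = C y forces M x = M y and N x = N y. Hence if no single
-- equality xᵢ = yᵢ follows from φ, amalgamating countermodels of all of them gives one model of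
-- φ refuting the whole disjunction. Excluded middle is needed to extract those countermodels.

open import Defs
open import Level using (0ℓ)
open import Axiom.ExcludedMiddle using (ExcludedMiddle)
open import Data.Bool using (Bool; true; false; if_then_else_)
open import Data.Empty using (⊥; ⊥-elim)
open import Data.List using (_∷_)
open import Data.List.NonEmpty using (List⁺; toList; _∷_)
open import Data.List.Relation.Unary.All as All using (All; []; _∷_)
open import Data.List.Relation.Unary.All.Properties using (¬Any⇒All¬; All¬⇒¬Any)
open import Data.List.Relation.Unary.Any using (Any)
open import Data.Product using (Σ; _×_; _,_; proj₁; proj₂; map₂)
open import Data.Product.Function.NonDependent.Propositional using (_×-⇔_)
open import Data.Sum using (_⊎_; inj₁; inj₂; [_,_])
open import Data.Sum.Function.Propositional using (_⊎-⇔_)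
open import Data.Unit using (⊤; tt)
open import Function using (_∘_)
open import Function.Bundles using (_⇔_; mk⇔; Equivalence)
open import Function.Construct.Composition using (_⇔-∘_)
open import Function.Construct.Identity using (⇔-id)
open import Function.Construct.Symmetry using (⇔-sym)
open import Function.Related.TypeIsomorphisms using (¬-cong-⇔)
open import Relation.Binary.Definitions using (Reflexive; Symmetric; Transitive; _Respectsʳ_; _Respectsˡ_)
open import Relation.Binary.PropositionalEquality using (_≡_; refl)
open import Relation.Nullary using (¬_)
open import Relation.Nullary.Decidable using (decidable-stable)

open Equivalence using (to; from)

private
  variable
    a b s s' n t t' u u' : V
    k j : Bool
    v w x y z : Var
    M N : Assignment
    φ : Conj

≐-refl : Reflexive _≐_
≐-refl {sup A f} = (λ i → i , ≐-refl) , (λ i → i , ≐-refl)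

≐-sym : Symmetric _≐_
≐-sym {sup A f} {sup B g} (p , q) = (λ j → map₂ ≐-sym (q j)) , (λ i → map₂ ≐-sym (p i))

≐-trans : Transitive _≐_
≐-trans {sup A f} {sup B g} {sup C h} (p , q) (r , s) =
  (λ i → let (j , fi≐gj) = p i ; (l , gj≐hl) = r j in l , ≐-trans fi≐gj gj≐hl) ,
  (λ l → let (j , gj≐hl) = s l ; (i , fi≐gj) = q j in i , ≐-trans fi≐gj gj≐hl)

∈-respʳ-≐ : _∈ᵥ_ Respectsʳ _≐_
∈-respʳ-≐ {_} {sup A f} {sup B g} (p , _) (i , t≐fi) =
  let (j , fi≐gj) = p i in j , ≐-trans t≐fi fi≐gj

∈-respˡ-≐ : _∈ᵥ_ Respectsˡ _≐_
∈-respˡ-≐ {sup B g} t≐t' (j , t≐gj) = j , ≐-trans (≐-sym t≐t') t≐gj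

≐⇒∈⇔ : t ≐ t' → t ∈ᵥ a ⇔ t' ∈ᵥ a
≐⇒∈⇔ t≐t' = mk⇔ (∈-respˡ-≐ t≐t') (∈-respˡ-≐ (≐-sym t≐t'))

≐-ext : (∀ {t} → t ∈ᵥ a → t ∈ᵥ b) → (∀ {t} → t ∈ᵥ b → t ∈ᵥ a) → a ≐ b
≐-ext {sup A f} {sup B g} a⊆b b⊆a =
  (λ i → a⊆b (i , ≐-refl)) , (λ j → map₂ ≐-sym (b⊆a (j , ≐-refl)))

≐-char : {P : V → Set} → (∀ {t} → t ∈ᵥ b ⇔ P t) → a ≐ b ⇔ (∀ {t} → t ∈ᵥ a ⇔ P t)
≐-char b-char = mk⇔
  (λ a≐b {_} → b-char ⇔-∘ mk⇔ (∈-respʳ-≐ a≐b) (∈-respʳ-≐ (≐-sym a≐b)))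
  (λ a-char → ≐-ext (λ {t} → from b-char ∘ to (a-char {t})) (λ {t} → from (a-char {t}) ∘ to b-char))

∉∅ᵥ : ¬ t ∈ᵥ ∅ᵥ
∉∅ᵥ (() , _)

∈-∪ᵥ : t ∈ᵥ (a ∪ᵥ b) ⇔ (t ∈ᵥ a ⊎ t ∈ᵥ b)
∈-∪ᵥ {a = sup A f} {sup B g} = mk⇔
  (λ { (inj₁ i , t≐) → inj₁ (i , t≐) ; (inj₂ j , t≐) → inj₂ (j , t≐) })
  (λ { (inj₁ (i , t≐)) → inj₁ i , t≐ ; (inj₂ (j , t≐)) → inj₂ j , t≐ })

∈-∩ᵥ : t ∈ᵥ (a ∩ᵥ b) ⇔ (t ∈ᵥ a × t ∈ᵥ b)
∈-∩ᵥ {a = sup A f} = mk⇔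
  (λ { ((i , fi∈b) , t≐fi) → (i , t≐fi) , ∈-respˡ-≐ (≐-sym t≐fi) fi∈b })
  (λ { ((i , t≐fi) , t∈b) → (i , ∈-respˡ-≐ t≐fi t∈b) , t≐fi })

∈-∖ᵥ : t ∈ᵥ (a ∖ᵥ b) ⇔ (t ∈ᵥ a × ¬ t ∈ᵥ b)
∈-∖ᵥ {a = sup A f} = mk⇔
  (λ { ((i , fi∉b) , t≐fi) → (i , t≐fi) , fi∉b ∘ ∈-respˡ-≐ t≐fi })
  (λ { ((i , t≐fi) , t∉b) → (i , t∉b ∘ ∈-respˡ-≐ (≐-sym t≐fi)) , t≐fi })

⊆ᵥ⇔ : a ⊆ᵥ b ⇔ (∀ {t} → t ∈ᵥ a → t ∈ᵥ b)
⊆ᵥ⇔ {sup A f} = mk⇔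
  (λ { a⊆b (i , t≐fi) → ∈-respˡ-≐ (≐-sym t≐fi) (a⊆b i) })
  (λ a⊆b i → a⊆b (i , ≐-refl))

data Connective : Set where
  none left and or andNot : Connective

_⟨_⟩_ : Set → Connective → Set → Set
A ⟨ none ⟩ B = ⊥
A ⟨ left ⟩ B = A
A ⟨ and ⟩ B = A × B
A ⟨ or ⟩ B = A ⊎ B
A ⟨ andNot ⟩ B = A × ¬ B

⟨⟩-cong : ∀ {A A' B B'} conn → A ⇔ A' → B ⇔ B' → A ⟨ conn ⟩ B ⇔ A' ⟨ conn ⟩ B'
⟨⟩-cong none _ _ = ⇔-id ⊥
⟨⟩-cong left A⇔A' _ = A⇔A'
⟨⟩-cong and A⇔A' B⇔B' = A⇔A' ×-⇔ B⇔B'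
⟨⟩-cong or A⇔A' B⇔B' = A⇔A' ⊎-⇔ B⇔B'
⟨⟩-cong andNot A⇔A' B⇔B' = A⇔A' ×-⇔ ¬-cong-⇔ B⇔B'

⟨⟩-strict : ∀ {A B} conn → A ⟨ conn ⟩ B → A ⊎ B
⟨⟩-strict left p = inj₁ p
⟨⟩-strict and (p , _) = inj₁ p
⟨⟩-strict or p = p
⟨⟩-strict andNot (p , _) = inj₁ p

Venn : Connective → V → V → V → Set₁
Venn conn a b c = ∀ {t} → t ∈ᵥ a ⇔ (t ∈ᵥ b) ⟨ conn ⟩ (t ∈ᵥ c)

⊆ᵥ⇔Venn : a ⊆ᵥ b ⇔ Venn and a a b
⊆ᵥ⇔Venn = mk⇔
  (λ a⊆b {t} → mk⇔ (λ t∈a → t∈a , to ⊆ᵥ⇔ a⊆b t∈a) proj₁)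
  (λ venn → from ⊆ᵥ⇔ λ {t} → proj₂ ∘ to (venn {t}))

data AtomView : Atom → Set₁ where
  membership : ∀ x y → AtomView (x ∈ₐ y)
  venn : ∀ {α} conn x y z → (∀ K → ⟦ α ⟧ᵃ K ⇔ Venn conn (K x) (K y) (K z)) → AtomView α

atomView : ∀ α → AtomView α
atomView (x =∅) = venn none x x x λ K → ≐-char (mk⇔ ∉∅ᵥ ⊥-elim)
atomView (x ≡ₐ y) = venn left x y y λ K → ≐-char (⇔-id _)
atomView (x ⊆ₐ y) = venn and x x y λ K → ⊆ᵥ⇔Venn
atomView (x ∈ₐ y) = membership x y
atomView (x ≔ y ∖ₐ z) = venn andNot x y z λ K → ≐-char ∈-∖ᵥ
atomView (x ≔ y ∪ₐ z) = venn or x y z λ K → ≐-char ∈-∪ᵥ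
atomView (x ≔ y ∩ₐ z) = venn and x y z λ K → ≐-char ∈-∩ᵥ

SameMembership : Assignment → V → Assignment → V → Set
SameMembership C t K e = ∀ y → t ∈ᵥ C y ⇔ e ∈ᵥ K y

Venn-transport : ∀ conn {C K t e} → SameMembership C t K e
  → e ∈ᵥ K x ⇔ (e ∈ᵥ K y) ⟨ conn ⟩ (e ∈ᵥ K z)
  → t ∈ᵥ C x ⇔ (t ∈ᵥ C y) ⟨ conn ⟩ (t ∈ᵥ C z)
Venn-transport {x} {y} {z} conn same e-venn =
  ⇔-sym (⟨⟩-cong conn (same y) (same z)) ⇔-∘ (e-venn ⇔-∘ same x)

-- Strictness of the connective puts every t satisfying the right-hand side into C y or C z,
-- where it has a representative.
Venn-amalgam : ∀ {I : Set} conn (K : I → Assignment) (C : Assignment)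
  → (∀ {t v} → t ∈ᵥ C v → Σ I λ i → Σ V λ e → SameMembership C t (K i) e)
  → (∀ i → Venn conn (K i x) (K i y) (K i z)) → Venn conn (C x) (C y) (C z)
Venn-amalgam {x} {y} {z} conn K C represent K-venn {t} = mk⇔
  (λ t∈Cx → to (transport (represent t∈Cx)) t∈Cx)
  (λ p → [ (λ t∈Cy → from (transport (represent t∈Cy)) p)
         , (λ t∈Cz → from (transport (represent t∈Cz)) p) ] (⟨⟩-strict conn p))
  where
  transport : (Σ _ λ i → Σ V λ e → SameMembership C t (K i) e)
    → t ∈ᵥ C x ⇔ (t ∈ᵥ C y) ⟨ conn ⟩ (t ∈ᵥ C z)
  transport (i , e , same) = Venn-transport conn same (K-venn i)

Venn-restrict : ∀ conn {C N : Assignment} (f : V → V) → (∀ u → SameMembership N u C (f u))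
  → Venn conn (C x) (C y) (C z) → Venn conn (N x) (N y) (N z)
Venn-restrict conn f embed C-venn {u} = Venn-transport conn (embed u) C-venn

single : V → V
single a = sup ⊤ (λ _ → a)

pair : V → V → V
pair a b = sup Bool (λ k → if k then a else b)

∈-pairˡ : a ∈ᵥ pair a b
∈-pairˡ = true , ≐-refl

∈-pairʳ : b ∈ᵥ pair a b
∈-pairʳ = false , ≐-refl

single-cong : a ≐ b → single a ≐ single b
single-cong a≐b = (λ _ → tt , a≐b) , (λ _ → tt , a≐b)

single-injective : single a ≐ single b → a ≐ b
single-injective (p , _) = proj₂ (p tt)

single≉∅ᵥ : ¬ single a ≐ ∅ᵥ
single≉∅ᵥ (p , _) = proj₁ (p tt)

Subsingleton : V → Set₁
Subsingleton a = ∀ {s t} → s ∈ᵥ a → t ∈ᵥ a → s ≐ t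

Subsingleton-resp : a ≐ b → Subsingleton a → Subsingleton b
Subsingleton-resp a≐b a-sub s∈b t∈b = a-sub (∈-respʳ-≐ (≐-sym a≐b) s∈b) (∈-respʳ-≐ (≐-sym a≐b) t∈b)

single-subsingleton : Subsingleton (single a)
single-subsingleton (_ , s≐a) (_ , t≐a) = ≐-trans s≐a (≐-sym t≐a)

∅ᵥ-subsingleton : Subsingleton ∅ᵥ
∅ᵥ-subsingleton s∈∅ = ⊥-elim (∉∅ᵥ s∈∅)

marker : Bool → V
marker k = pair ∅ᵥ (single (if k then ∅ᵥ else single ∅ᵥ))

∅ᵥ∈marker : ∅ᵥ ∈ᵥ marker k
∅ᵥ∈marker = true , ≐-refl

marker-not-subsingleton : ¬ Subsingleton (marker k)
marker-not-subsingleton {k} marker-sub =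
  single≉∅ᵥ (marker-sub {single (if k then ∅ᵥ else single ∅ᵥ)} (false , ≐-refl) ∅ᵥ∈marker)

marker-elements-subsingleton : t ∈ᵥ marker k → Subsingleton t
marker-elements-subsingleton (true , t≐∅) = Subsingleton-resp (≐-sym t≐∅) ∅ᵥ-subsingleton
marker-elements-subsingleton (false , t≐single) = Subsingleton-resp (≐-sym t≐single) single-subsingleton

marker≉single : ¬ marker k ≐ single u
marker≉single marker≐single =
  marker-not-subsingleton (Subsingleton-resp (≐-sym marker≐single) single-subsingleton)

markers-distinct : ¬ marker true ≐ marker false
markers-distinct e with ∈-respʳ-≐ e (∈-pairʳ {b = single ∅ᵥ} {a = ∅ᵥ})
... | true , single∅≐∅ = single≉∅ᵥ single∅≐∅
... | false , single∅≐single² = single≉∅ᵥ (≐-sym (single-injective {a = ∅ᵥ} {b = single ∅ᵥ} single∅≐single²))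

marker-injective : marker k ≐ marker j → k ≡ j
marker-injective {true} {true} _ = refl
marker-injective {false} {false} _ = refl
marker-injective {true} {false} e = ⊥-elim (markers-distinct e)
marker-injective {false} {true} e = ⊥-elim (markers-distinct (≐-sym e))

marker∉marker : ¬ marker j ∈ᵥ marker k
marker∉marker m = marker-not-subsingleton (marker-elements-subsingleton m)

tag : Bool → V → V
tag k u = pair (marker k) (single u)

marker∈tag : marker k ∈ᵥ tag k u
marker∈tag = ∈-pairˡ

tag∉marker : ¬ tag j u ∈ᵥ marker k
tag∉marker {j} {u} m =
  marker≉single (marker-elements-subsingleton m marker∈tag (∈-pairʳ {b = single u} {a = marker j}))

tag-cong : u ≐ u' → tag k u ≐ tag k u'
tag-cong u≐u' =
  (λ { true → true , ≐-refl ; false → false , single-cong u≐u' }) ,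
  (λ { true → true , ≐-refl ; false → false , single-cong u≐u' })

tag-injective : tag k u ≐ tag j u' → k ≡ j × u ≐ u'
tag-injective {k} {u} {j} {u'} tag≐tag =
  same-marker (∈-respʳ-≐ tag≐tag marker∈tag) , same-content (∈-respʳ-≐ tag≐tag ∈-pairʳ)
  where
  same-marker : marker k ∈ᵥ tag j u' → k ≡ j
  same-marker (true , e) = marker-injective e
  same-marker (false , e) = ⊥-elim (marker≉single e)
  same-content : single u ∈ᵥ tag j u' → u ≐ u'
  same-content (true , e) = ⊥-elim (marker≉single (≐-sym e))
  same-content (false , e) = single-injective e

module Amalgamation (M N : Assignment) where

  K : Bool → Assignment
  K k v = if k then M v else N v

  -- merge (M w) (N w) is C w; the members C w' are produced by recursion on M w, as merges of
  -- members of M w that equal M w' only up to _≐_.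
  merge : V → V → V
  merge (sup A f) (sup B g) = sup ((Σ Var λ w → M w ∈ᵥ sup A f) ⊎ A ⊎ B) element
    where
    element : (Σ Var λ w → M w ∈ᵥ sup A f) ⊎ A ⊎ B → V
    element (inj₁ (w , i , _)) = merge (f i) (N w)
    element (inj₂ (inj₁ i)) = tag true (f i)
    element (inj₂ (inj₂ j)) = tag false (g j)

  C : Assignment
  C w = merge (M w) (N w)

  merge-cong : s ≐ s' → merge s n ≐ merge s' n
  ∈-merge-resp : s ≐ s' → t ∈ᵥ merge s n → t ∈ᵥ merge s' n

  merge-cong s≐s' = ≐-ext (∈-merge-resp s≐s') (∈-merge-resp (≐-sym s≐s'))

  ∈-merge-resp {sup A f} {sup A' f'} {n = sup B g} (p , _) (inj₁ (w , i , Mw≐fi) , t≐) =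
    let (i' , fi≐f'i') = p i in inj₁ (w , i' , ≐-trans Mw≐fi fi≐f'i') , ≐-trans t≐ (merge-cong fi≐f'i')
  ∈-merge-resp {sup A f} {sup A' f'} {n = sup B g} (p , _) (inj₂ (inj₁ i) , t≐) =
    let (i' , fi≐f'i') = p i in inj₂ (inj₁ i') , ≐-trans t≐ (tag-cong {k = true} fi≐f'i')
  ∈-merge-resp {sup A f} {sup A' f'} {n = sup B g} _ (inj₂ (inj₂ j) , t≐) = inj₂ (inj₂ j) , t≐

  data Element (s n t : V) : Set₁ where
    value : ∀ w → M w ∈ᵥ s → t ≐ C w → Element s n t
    tagged : ∀ k {u} → u ∈ᵥ (if k then s else n) → t ≐ tag k u → Element s n t

  ∈-merge⁻ : t ∈ᵥ merge s n → Element s n t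
  ∈-merge⁻ {s = sup A f} {sup B g} (inj₁ (w , i , Mw≐fi) , t≐) =
    value w (i , Mw≐fi) (≐-trans t≐ (merge-cong (≐-sym Mw≐fi)))
  ∈-merge⁻ {s = sup A f} {sup B g} (inj₂ (inj₁ i) , t≐) = tagged true (i , ≐-refl) t≐
  ∈-merge⁻ {s = sup A f} {sup B g} (inj₂ (inj₂ j) , t≐) = tagged false (j , ≐-refl) t≐

  C-∈-merge : M w ∈ᵥ s → C w ∈ᵥ merge s n
  C-∈-merge {w} {sup A f} {sup B g} (i , Mw≐fi) = inj₁ (w , i , Mw≐fi) , merge-cong Mw≐fi

  tag-∈-merge : ∀ k → u ∈ᵥ (if k then s else n) → tag k u ∈ᵥ merge s n
  tag-∈-merge {s = sup A f} {sup B g} true (i , u≐fi) = inj₂ (inj₁ i) , tag-cong {k = true} u≐fi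
  tag-∈-merge {s = sup A f} {sup B g} false (j , u≐gj) = inj₂ (inj₂ j) , tag-cong {k = false} u≐gj

  tag-∈C : ∀ k → u ∈ᵥ K k v → tag k u ∈ᵥ C v
  tag-∈C k = tag-∈-merge k

  nonempty-C-contains-tag : t ∈ᵥ C v → Σ Bool λ k → Σ V λ u → tag k u ∈ᵥ C v
  nonempty-C-contains-tag t∈Cv with ∈-merge⁻ t∈Cv
  ... | value w Mw∈Mv _ = true , M w , tag-∈C true Mw∈Mv
  ... | tagged k {u} _ t≐tag = k , u , ∈-respˡ-≐ t≐tag t∈Cv

  -- The marker of the tag would be a member of C w, hence a value C w' (markers are not tags).
  -- Since ∅ᵥ ∈ marker, that C w' is nonempty and so contains a tag; but no tag is in a marker.
  C≉tag : ¬ C w ≐ tag k u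
  C≉tag C≐tag with ∈-merge⁻ (∈-respʳ-≐ (≐-sym C≐tag) marker∈tag)
  ... | value w' _ marker≐C =
    let (j , u' , tag∈C) = nonempty-C-contains-tag (∈-respʳ-≐ marker≐C ∅ᵥ∈marker)
    in tag∉marker (∈-respʳ-≐ (≐-sym marker≐C) tag∈C)
  ... | tagged j _ marker≐tag = marker∉marker (∈-respʳ-≐ (≐-sym marker≐tag) marker∈tag)

  tag-∈C⁻ : tag k u ∈ᵥ C v → u ∈ᵥ K k v
  tag-∈C⁻ tag∈Cv with ∈-merge⁻ tag∈Cv
  ... | value w _ tag≐C = ⊥-elim (C≉tag (≐-sym tag≐C))
  ... | tagged j u'∈ tag≐tag with tag-injective tag≐tag
  ...   | refl , u≐u' = ∈-respˡ-≐ (≐-sym u≐u') u'∈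

  tag-∈C⇔ : ∀ k → tag k u ∈ᵥ C v ⇔ u ∈ᵥ K k v
  tag-∈C⇔ k = mk⇔ tag-∈C⁻ (tag-∈C k)

  C-reflects-≐ : C x ≐ C y → ∀ k → K k x ≐ K k y
  C-reflects-≐ Cx≐Cy k =
    ≐-ext (λ u∈ → tag-∈C⁻ (∈-respʳ-≐ Cx≐Cy (tag-∈C k u∈)))
          (λ u∈ → tag-∈C⁻ (∈-respʳ-≐ (≐-sym Cx≐Cy) (tag-∈C k u∈)))

  C-∈C⇔ : C w ∈ᵥ C v ⇔ M w ∈ᵥ M v
  C-∈C⇔ = mk⇔ C-∈C⁻ C-∈-merge
    where
    C-∈C⁻ : C w ∈ᵥ C v → M w ∈ᵥ M v
    C-∈C⁻ Cw∈Cv with ∈-merge⁻ Cw∈Cv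
    ... | value w' Mw'∈Mv Cw≐Cw' = ∈-respˡ-≐ (≐-sym (C-reflects-≐ Cw≐Cw' true)) Mw'∈Mv
    ... | tagged k _ Cw≐tag = ⊥-elim (C≉tag Cw≐tag)

  represent : t ∈ᵥ C v → Σ Bool λ k → Σ V λ e → SameMembership C t (K k) e
  represent t∈Cv with ∈-merge⁻ t∈Cv
  ... | value w _ t≐Cw = true , M w , λ y → C-∈C⇔ ⇔-∘ ≐⇒∈⇔ t≐Cw
  ... | tagged k {u} _ t≐tag = k , u , λ y → tag-∈C⇔ k ⇔-∘ ≐⇒∈⇔ t≐tag

  C-satisfies : ∀ l → ⟦ l ⟧ˡ M → ⟦ l ⟧ˡ N → ⟦ l ⟧ˡ C
  C-satisfies (pos α) with atomView α
  ... | membership x y = λ Mx∈My _ → from C-∈C⇔ Mx∈My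
  ... | venn conn x y z holds⇔ = λ Mα Nα → from (holds⇔ C) (Venn-amalgam conn K C represent
          λ { true → to (holds⇔ M) Mα ; false → to (holds⇔ N) Nα })
  C-satisfies (neg α) with atomView α
  ... | membership x y = λ Mx∉My _ Cx∈Cy → Mx∉My (to C-∈C⇔ Cx∈Cy)
  ... | venn conn x y z holds⇔ = λ _ ¬Nα Cα →
          ¬Nα (from (holds⇔ N)
            (Venn-restrict conn {C} (tag false) (λ _ _ → ⇔-sym (tag-∈C⇔ false)) (to (holds⇔ C) Cα)))

amalgamate : ⟦ φ ⟧ᶜ M → ⟦ φ ⟧ᶜ N
  → Σ Assignment λ C → ⟦ φ ⟧ᶜ C × (∀ {x y} → C x ≐ C y → M x ≐ M y × N x ≐ N y)
amalgamate {M = M} {N = N} φM φN =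
  C , All.zipWith (λ {l} (Ml , Nl) → C-satisfies l Ml Nl) (φM , φN) ,
  λ Cx≐Cy → C-reflects-≐ Cx≐Cy true , C-reflects-≐ Cx≐Cy false
  where open Amalgamation M N

Countermodel : Conj → Equality → Set₁
Countermodel φ e = Σ Assignment λ K → ⟦ φ ⟧ᶜ K × ¬ ⟦ e ⟧ᵉ K

countermodel : ExcludedMiddle 0ℓ → ExcludedMiddle (Level.suc 0ℓ)
  → ∀ {φ e} → ¬ ValidImpEq φ e → Countermodel φ e
countermodel em₀ em₁ invalid = decidable-stable em₁ λ no-countermodel →
  invalid λ K φK → decidable-stable em₀ λ K-refutes → no-countermodel (K , φK , K-refutes)

refute-all : ∀ {e es} → All (Countermodel φ) (e ∷ es)
  → Σ Assignment λ K → ⟦ φ ⟧ᶜ K × All (λ e → ¬ ⟦ e ⟧ᵉ K) (e ∷ es)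
refute-all ((K , φK , K-refutes) ∷ []) = K , φK , K-refutes ∷ []
refute-all ((M , φM , M-refutes) ∷ countermodels@(_ ∷ _)) =
  let (N , φN , N-refutes) = refute-all countermodels
      (C , φC , C-reflects) = amalgamate φM φN
  in C , φC ,
     (M-refutes ∘ proj₁ ∘ C-reflects) ∷ All.map (λ refutes → refutes ∘ proj₂ ∘ C-reflects) N-refutes

mainTheorem1 : ExcludedMiddle 0ℓ → ExcludedMiddle (Level.suc 0ℓ)
    → (φ : Conj) (eqs : List⁺ Equality)
    → ValidImpDisj φ eqs
    → Any (λ e → ValidImpEq φ e) (toList eqs)
mainTheorem1 em₀ em₁ φ eqs valid = decidable-stable em₁ λ none-valid →
  let countermodels = All.map (countermodel em₀ em₁) (¬Any⇒All¬ (toList eqs) none-valid)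
      (K , φK , K-refutes) = refute-all countermodels
  in All¬⇒¬Any K-refutes (valid K φK)
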